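{- Let $\mathcal U$ be a countably infinite set of constants and consider relational databases $B=\langle R_1,\dots,R_n\rangle$ of finite relations over $\mathcal U$, with predicate symbols $r_1,\dots,r_n$ naming them. For every domain-independent constraint $c$ (a closed first-order formula), every relation symbol $r$, every domain-independent first-order formula $\Phi(\overline x)$ with free variables $\overline x$ (of the arity of $r$), every domain-independent first-order sentence $cond$, and all instructions $i_1,i_2,inst1,inst2$ of the update language, the following formulas are weakest preconditions for the indicated instruction and constraint $c$: 1. $wp(\texttt{foreach }\overline x:\Phi(\overline x)\texttt{ do }insert_R(\overline x),\,c)=c[r\rightarrow r\cup\Phi]$; 2. $wp(\texttt{foreach }\overline x:\Phi(\overline x)\texttt{ do }delete_R(\overline x),\,c)=c[r\rightarrow r-\Phi]$; 3. $wp((i_1;i_2),c)=wp(i_1,wp(i_2,c))$; 4. $wp(\texttt{if }cond\texttt{ then }inst1\texttt{ else }inst2,\,c)=\big(cond\wedge wp(inst1,c)\big)\vee\big(\neg cond\wedge wp(inst2,c)\big)$.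
   Context: An update maps a database $B=\langle R_1,\dots,R_n\rangle$ to $u(B)=\langle R_1',\dots,R_n'\rangle$ with $R_i'$ of the same arity as $R_i$. Instructions are built as: $I_1$: $\texttt{foreach }\overline x:\Phi(\overline x)\texttt{ do }insert_R(\overline x)$; $I_2$: $\texttt{foreach }\overline x:\Phi(\overline x)\texttt{ do }delete_R(\overline x)$; $I_3$: if $i_1,i_2$ are instructions, $(i_1;i_2)$ is an instruction; $I_4$: $\texttt{if }cond\texttt{ then }inst1\texttt{ else }inst2$ (else-branch optional), where $\Phi$ is a domain-independent first-order formula and $cond$ a domain-independent first-order sentence. Semantics: $I_1(B)=B[R\rightarrow R\cup\{\overline x\mid B\models\Phi(\overline x)\}]$; $I_2(B)=B[R\rightarrow R-\{\overline x\mid B\models\Phi(\overline x)\}]$; $(i_1;i_2)(B)=i_2(i_1(B))$; $I_4(B)=inst1(B)$ if $B\models cond$ and $inst2(B)$ if $B\models\neg cond$. Here $B[R\rightarrow R']$ is $B$ with relation $R$ replaced by $R'$. For a formula $c$, $c[r\rightarrow r\cup\phi]$ (resp. $c[r\rightarrow r-\phi]$) is obtained by substituting $r(\overline s)\vee\phi(\overline s)$ (resp. $r(\overline s)\wedge\neg\phi(\overline s)$) for every occurrence of $r(\overline s)$ in $c$. A formula $f$ is a precondition for update $u$ and constraint $c$ if for every database $B$, $B\models f$ implies $u(B)\models c$ (regardless of whether $B\models c$). $f$ is weaker than $g$ if for every $B$, $B\models g$ implies $B\models f$. A weakest precondition for $(u,c)$ is a precondition weaker than every precondition for $(u,c)$.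 -}

module Defs where

open import Data.Nat using (ℕ; zero; suc)
import Data.Nat as ℕ
open import Data.Fin using (Fin; zero; suc; _≟_)
open import Data.Bool using (Bool; true; false; not; _∧_; _∨_; if_then_else_)
open import Data.List using (List; []; _∷_; _++_; map; concatMap; allFin; filterᵇ)
open import Data.Bool.ListAction using (any; all)
open import Data.List.Membership.Propositional using (_∈_)
open import Data.List.Relation.Binary.Subset.Propositional using (_⊆_)
open import Data.Vec using (Vec; []; _∷_; lookup; toList)
import Data.Vec as Vec
open import Data.Vec.Properties using (≡-dec)
open import Data.Product using (_×_)
open import Relation.Nullary using (does)
open import Relation.Binary.PropositionalEquality using (_≡_; refl)
open import Function.Bundles using (_⇔_)

-- The countably infinite set of constants 𝒰 is ℕ.
-- A schema: n relation symbols r_0 … r_{n-1}, symbol i has arity ar i.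
module WithSchema (n : ℕ) (ar : Fin n → ℕ) where

  DB : Set
  DB = (i : Fin n) → List (Vec ℕ (ar i))

  -- First-order formulas over the schema, with constants from ℕ and
  -- well-scoped de Bruijn variables (Formula m: free variables among Fin m).
  data Term (m : ℕ) : Set where
    var   : Fin m → Term m
    const : ℕ → Term m

  infix  7 _≐_
  infixr 6 _∧ᶠ_
  infixr 5 _∨ᶠ_
  infix  8 ¬ᶠ_

  data Formula (m : ℕ) : Set where
    rel   : (i : Fin n) → Vec (Term m) (ar i) → Formula m
    _≐_   : Term m → Term m → Formula m
    ¬ᶠ_   : Formula m → Formula m
    _∧ᶠ_  : Formula m → Formula m → Formula m
    _∨ᶠ_  : Formula m → Formula m → Formula m
    ∃ᶠ    : Formula (suc m) → Formula m
    ∀ᶠ    : Formula (suc m) → Formula m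

  Sentence : Set
  Sentence = Formula 0

  liftTerm : ∀ {m m'} → (Fin m → Term m') → Fin (suc m) → Term (suc m')
  liftTerm σ zero    = var zero
  liftTerm σ (suc i) with σ i
  ... | var j   = var (suc j)
  ... | const a = const a

  substT : ∀ {m m'} → (Fin m → Term m') → Term m → Term m'
  substT σ (var i)   = σ i
  substT σ (const a) = const a

  substF : ∀ {m m'} → (Fin m → Term m') → Formula m → Formula m'
  substF σ (rel i ts) = rel i (Vec.map (substT σ) ts)
  substF σ (t ≐ u)    = substT σ t ≐ substT σ u
  substF σ (¬ᶠ φ)     = ¬ᶠ substF σ φ
  substF σ (φ ∧ᶠ ψ)   = substF σ φ ∧ᶠ substF σ ψ
  substF σ (φ ∨ᶠ ψ)   = substF σ φ ∨ᶠ substF σ ψ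
  substF σ (∃ᶠ φ)     = ∃ᶠ (substF (liftTerm σ) φ)
  substF σ (∀ᶠ φ)     = ∀ᶠ (substF (liftTerm σ) φ)

  instantiate : ∀ {k m} → Formula k → Vec (Term m) k → Formula m
  instantiate Φ ss = substF (lookup ss) Φ

  replaceRel : (r : Fin n) → (∀ {m} → Vec (Term m) (ar r) → Formula m)
             → ∀ {m} → Formula m → Formula m
  replaceRel r F (rel i ts) with i ≟ r
  ... | Relation.Nullary.yes refl = F ts
  ... | Relation.Nullary.no _     = rel i ts
  replaceRel r F (t ≐ u)  = t ≐ u
  replaceRel r F (¬ᶠ φ)   = ¬ᶠ replaceRel r F φ
  replaceRel r F (φ ∧ᶠ ψ) = replaceRel r F φ ∧ᶠ replaceRel r F ψ
  replaceRel r F (φ ∨ᶠ ψ) = replaceRel r F φ ∨ᶠ replaceRel r F ψ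
  replaceRel r F (∃ᶠ φ)   = ∃ᶠ (replaceRel r F φ)
  replaceRel r F (∀ᶠ φ)   = ∀ᶠ (replaceRel r F φ)

  _[_↦r∪_] : ∀ {m} → Formula m → (r : Fin n) → Formula (ar r) → Formula m
  c [ r ↦r∪ Φ ] = replaceRel r (λ ss → rel r ss ∨ᶠ instantiate Φ ss) c

  _[_↦r-_] : ∀ {m} → Formula m → (r : Fin n) → Formula (ar r) → Formula m
  c [ r ↦r- Φ ] = replaceRel r (λ ss → rel r ss ∧ᶠ ¬ᶠ instantiate Φ ss) c

  -- Semantics relative to a finite domain D ⊆ 𝒰 (quantifiers range over D)
  evalT : ∀ {m} → (Fin m → ℕ) → Term m → ℕ
  evalT ρ (var i)   = ρ i
  evalT ρ (const a) = a

  memb : ∀ {k} → Vec ℕ k → List (Vec ℕ k) → Bool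
  memb t R = any (λ s → does (≡-dec ℕ._≟_ s t)) R

  extend : ∀ {m} → ℕ → (Fin m → ℕ) → Fin (suc m) → ℕ
  extend a ρ zero    = a
  extend a ρ (suc i) = ρ i

  eval : (D : List ℕ) → DB → ∀ {m} → Formula m → (Fin m → ℕ) → Bool
  eval D B (rel i ts) ρ = memb (Vec.map (evalT ρ) ts) (B i)
  eval D B (t ≐ u)    ρ = does (evalT ρ t ℕ.≟ evalT ρ u)
  eval D B (¬ᶠ φ)     ρ = not (eval D B φ ρ)
  eval D B (φ ∧ᶠ ψ)   ρ = eval D B φ ρ ∧ eval D B ψ ρ
  eval D B (φ ∨ᶠ ψ)   ρ = eval D B φ ρ ∨ eval D B ψ ρ
  eval D B (∃ᶠ φ)     ρ = any (λ a → eval D B φ (extend a ρ)) D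
  eval D B (∀ᶠ φ)     ρ = all (λ a → eval D B φ (extend a ρ)) D

  adom : DB → List ℕ
  adom B = concatMap (λ i → concatMap toList (B i)) (allFin n)

  constsT : ∀ {m} → Term m → List ℕ
  constsT (var _)   = []
  constsT (const a) = a ∷ []

  consts : ∀ {m} → Formula m → List ℕ
  consts (rel i ts) = concatMap constsT (toList ts)
  consts (t ≐ u)    = constsT t ++ constsT u
  consts (¬ᶠ φ)     = consts φ
  consts (φ ∧ᶠ ψ)   = consts φ ++ consts ψ
  consts (φ ∨ᶠ ψ)   = consts φ ++ consts ψ
  consts (∃ᶠ φ)     = consts φ
  consts (∀ᶠ φ)     = consts φ

  DomInd : ∀ {m} → Formula m → Set
  DomInd {m} φ = ∀ (B : DB) (D₁ D₂ : List ℕ)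
    → adom B ++ consts φ ⊆ D₁ → adom B ++ consts φ ⊆ D₂
    → (ρ : Fin m → ℕ)
    → (((i : Fin m) → ρ i ∈ D₁) × eval D₁ B φ ρ ≡ true)
      ⇔ (((i : Fin m) → ρ i ∈ D₂) × eval D₂ B φ ρ ≡ true)

  -- B ⊨ f (evaluated over the active domain of B and f; for
  -- domain-independent f this coincides with evaluation over 𝒰)
  satB : DB → Sentence → Bool
  satB B f = eval (adom B ++ consts f) B f (λ ())

  _⊨_ : DB → Sentence → Set
  B ⊨ f = satB B f ≡ true

  data Instr : Set where
    foreachInsert : (r : Fin n) (Φ : Formula (ar r)) → DomInd Φ → Instr
    foreachDelete : (r : Fin n) (Φ : Formula (ar r)) → DomInd Φ → Instr
    _⨾_           : Instr → Instr → Instr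
    ifThenElse    : (cond : Sentence) → DomInd cond → Instr → Instr → Instr
    ifThen        : (cond : Sentence) → DomInd cond → Instr → Instr

  tuples : (k : ℕ) → List ℕ → List (Vec ℕ k)
  tuples zero    D = [] ∷ []
  tuples (suc k) D = concatMap (λ a → map (a ∷_) (tuples k D)) D

  answer : ∀ {k} → DB → Formula k → List (Vec ℕ k)
  answer {k} B Φ = filterᵇ (λ t → eval D B Φ (lookup t)) (tuples k D)
    where D = adom B ++ consts Φ

  _[_≔_] : DB → (r : Fin n) → List (Vec ℕ (ar r)) → DB
  (B [ r ≔ R' ]) i with i ≟ r
  ... | Relation.Nullary.yes refl = R'
  ... | Relation.Nullary.no _     = B i

  run : Instr → DB → DB
  run (foreachInsert r Φ _) B = B [ r ≔ B r ++ answer B Φ ]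
  run (foreachDelete r Φ _) B = B [ r ≔ filterᵇ (λ t → not (memb t (answer B Φ))) (B r) ]
  run (i₁ ⨾ i₂) B = run i₂ (run i₁ B)
  run (ifThenElse cond _ i₁ i₂) B = if satB B cond then run i₁ B else run i₂ B
  run (ifThen cond _ i) B = if satB B cond then run i B else B

  IsPrecond : Instr → Sentence → Sentence → Set
  IsPrecond u c f = ∀ (B : DB) → B ⊨ f → run u B ⊨ c

  Weaker : Sentence → Sentence → Set
  Weaker f g = ∀ (B : DB) → B ⊨ g → B ⊨ f

  IsWP : Instr → Sentence → Sentence → Set
  IsWP u c f = DomInd f × IsPrecond u c f
             × (∀ (g : Sentence) → DomInd g → IsPrecond u c g → Weaker f g)

{-# OPTIONS --safe #-}
module Submission where

-- Call w an exact precondition of a transformation f for c when B ⊨ w ⇔ f B ⊨ c for every B.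
-- For domain-independent c, every instruction has a domain-independent exact precondition.
-- For the foreach instructions it is the substituted constraint: evaluating r(s̄) ∨ Φ(s̄)
-- (resp. r(s̄) ∧ ¬Φ(s̄)) in B is evaluating r(s̄) in the updated database, because by domain
-- independence of Φ its answer may be computed over any large enough domain. Exact
-- preconditions compose along sequences and combine by cases on cond in conditionals. A
-- weakest precondition is a precondition weaker than the exact one, hence itself exact; so
-- exactness propagates through the four formulas of the theorem.

open import Defs
open import Data.Nat using (ℕ; zero; suc)
import Data.Nat as ℕ
open import Data.Fin using (Fin; zero; suc; _≟_)
import Data.Product as Product
open import Data.Product using (_×_; _,_; proj₁; proj₂; ∃-syntax)
open import Data.Sum using ([_,_]′)
open import Data.Bool using (Bool; true; false; not; _∧_; _∨_; if_then_else_)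
open import Data.Bool.Properties
  using (⇔→≡; ∧-conicalˡ; ∧-conicalʳ; ∧-zeroʳ; ∨-zeroʳ; ∨-identityʳ; ∨-assoc; if-float; if-cong₂)
open import Data.Bool.ListAction using (any; all; and; or)
open import Data.List using (List; []; _∷_; _++_; map; concatMap; allFin; filterᵇ)
open import Data.List.Properties using (map-cong-local; concatMap-++)
open import Data.List.Relation.Unary.All using (tabulate)
open import Data.List.Relation.Unary.Any using (here; there)
open import Data.List.Membership.Propositional using (_∈_; lose; find)
open import Data.List.Membership.Propositional.Properties
  using (∈-++⁺ˡ; ∈-++⁺ʳ; ∈-++⁻; ∈-map⁺; ∈-map⁻; ∈-concatMap⁺; ∈-concatMap⁻; ∈-allFin)
open import Data.List.Relation.Binary.Subset.Propositional using (_⊆_)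
open import Data.List.Relation.Binary.Subset.Propositional.Properties
  using (⊆-refl; ⊆-reflexive; ⊆-trans; xs⊆xs++ys; xs⊆ys++xs; ++⁺; ++⁺ʳ; filter-⊆; concatMap⁺)
open import Data.Vec using (Vec; []; _∷_; lookup; toList)
import Data.Vec as Vec
open import Data.Vec.Properties using (≡-dec; lookup-map)
import Data.Vec.Properties as Vec
open import Data.Vec.Membership.Propositional.Properties using (∈-toList⁻)
open import Data.Vec.Relation.Unary.Any using (index)
open import Data.Vec.Relation.Unary.Any.Properties using (lookup-index)
open import Function using (_∘_; mk⇔; Equivalence)
open import Relation.Nullary using (yes; no; does)
open import Relation.Nullary.Decidable using (dec-true)
open import Relation.Binary.PropositionalEquality
  using (_≡_; refl; sym; trans; cong; cong₂; subst; module ≡-Reasoning)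

++-⊆ : ∀ {A : Set} {xs ys zs : List A} → xs ⊆ zs → ys ⊆ zs → xs ++ ys ⊆ zs
++-⊆ {xs = xs} xs⊆zs ys⊆zs = [ xs⊆zs , ys⊆zs ]′ ∘ ∈-++⁻ xs

any-cong : ∀ {A : Set} {f g : A → Bool} (xs : List A)
  → (∀ {x} → x ∈ xs → f x ≡ g x) → any f xs ≡ any g xs
any-cong _ = cong or ∘ map-cong-local ∘ tabulate

all-cong : ∀ {A : Set} {f g : A → Bool} (xs : List A)
  → (∀ {x} → x ∈ xs → f x ≡ g x) → all f xs ≡ all g xs
all-cong _ = cong and ∘ map-cong-local ∘ tabulate

∧-∨-not≡if : ∀ b x y → (b ∧ x) ∨ (not b ∧ y) ≡ (if b then x else y)
∧-∨-not≡if true  x y = ∨-identityʳ x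
∧-∨-not≡if false x y = refl

module _ (n : ℕ) (ar : Fin n → ℕ) where
  open WithSchema n ar

  entries : ∀ {k} → List (Vec ℕ k) → List ℕ
  entries = concatMap toList

  memb-sound : ∀ {k} {t : Vec ℕ k} {R} → memb t R ≡ true → t ∈ R
  memb-sound {t = t} {s ∷ R} h with ≡-dec ℕ._≟_ s t
  ... | yes refl = here refl
  ... | no _     = there (memb-sound h)

  memb-complete : ∀ {k} {t : Vec ℕ k} {R} → t ∈ R → memb t R ≡ true
  memb-complete {t = t} (here refl) rewrite dec-true (≡-dec ℕ._≟_ t t) refl = refl
  memb-complete (there t∈R) = trans (cong (_ ∨_) (memb-complete t∈R)) (∨-zeroʳ _)

  memb-++ : ∀ {k} (t : Vec ℕ k) R S → memb t (R ++ S) ≡ memb t R ∨ memb t S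
  memb-++ t []      S = refl
  memb-++ t (s ∷ R) S = trans (cong (_ ∨_) (memb-++ t R S))
    (sym (∨-assoc (does (≡-dec ℕ._≟_ s t)) (memb t R) (memb t S)))

  memb-filterᵇ : ∀ {k} (p : Vec ℕ k → Bool) t R → memb t (filterᵇ p R) ≡ memb t R ∧ p t
  memb-filterᵇ p t []      = refl
  memb-filterᵇ p t (s ∷ R) with p s in ps
  ... | true with ≡-dec ℕ._≟_ s t
  ...   | yes refl = sym ps
  ...   | no _     = memb-filterᵇ p t R
  memb-filterᵇ p t (s ∷ R) | false with ≡-dec ℕ._≟_ s t
  ...   | yes refl rewrite memb-filterᵇ p s R | ps = ∧-zeroʳ _
  ...   | no _     = memb-filterᵇ p t R

  ∈-tuples⁺ : ∀ {k D} {t : Vec ℕ k} → (∀ i → lookup t i ∈ D) → t ∈ tuples k D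
  ∈-tuples⁺ {t = []}            t∈D = here refl
  ∈-tuples⁺ {suc k} {D} {a ∷ t} t∈D = ∈-concatMap⁺ (λ a → map (a ∷_) (tuples k D))
    (lose (t∈D zero) (∈-map⁺ (a ∷_) (∈-tuples⁺ (t∈D ∘ suc))))

  ∈-tuples⁻ : ∀ {k D} {t : Vec ℕ k} → t ∈ tuples k D → ∀ i → lookup t i ∈ D
  ∈-tuples⁻ {suc k} {D} at∈ with find (∈-concatMap⁻ (λ a → map (a ∷_) (tuples k D)) {xs = D} at∈)
  ... | a , a∈D , at∈′ with ∈-map⁻ (a ∷_) at∈′
  ... | t , t∈ , refl = λ { zero → a∈D ; (suc i) → ∈-tuples⁻ t∈ i }

  toList-⊆ : ∀ {k D} {t : Vec ℕ k} → (∀ i → lookup t i ∈ D) → toList t ⊆ D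
  toList-⊆ {D = D} t∈D a∈t = subst (_∈ D) (sym (lookup-index a∈t′)) (t∈D (index a∈t′))
    where a∈t′ = ∈-toList⁻ a∈t

  entries-⊆-adom : ∀ B i → entries (B i) ⊆ adom B
  entries-⊆-adom B i = ∈-concatMap⁺ (entries ∘ B) ∘ lose (∈-allFin i)

  adom-[≔]-⊆ : ∀ B r (R : List (Vec ℕ (ar r))) → adom (B [ r ≔ R ]) ⊆ adom B ++ entries R
  adom-[≔]-⊆ B r R a∈ with find (∈-concatMap⁻ (entries ∘ (B [ r ≔ R ])) {xs = allFin n} a∈)
  ... | i , _ , a∈Bi = entries-[≔] i a∈Bi
    where
    entries-[≔] : ∀ i → entries ((B [ r ≔ R ]) i) ⊆ adom B ++ entries R
    entries-[≔] i with i ≟ r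
    ... | yes refl = ∈-++⁺ʳ (adom B)
    ... | no _     = ∈-++⁺ˡ ∘ entries-⊆-adom B i

  liftTerm-eval : ∀ {m m'} (σ : Fin m → Term m') {ρ : Fin m' → ℕ} {ρ' : Fin m → ℕ} a
    → (∀ i → evalT ρ (σ i) ≡ ρ' i) → ∀ i → evalT (extend a ρ) (liftTerm σ i) ≡ extend a ρ' i
  liftTerm-eval σ a σρ≗ρ' zero = refl
  liftTerm-eval σ a σρ≗ρ' (suc i) with σ i | σρ≗ρ' i
  ... | var j   | eq = eq
  ... | const b | eq = eq

  substT-eval : ∀ {m m'} {σ : Fin m → Term m'} {ρ : Fin m' → ℕ} {ρ' : Fin m → ℕ}
    → (∀ i → evalT ρ (σ i) ≡ ρ' i) → ∀ t → evalT ρ (substT σ t) ≡ evalT ρ' t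
  substT-eval σρ≗ρ' (var i)   = σρ≗ρ' i
  substT-eval σρ≗ρ' (const a) = refl

  substF-eval : ∀ {D B m m'} (σ : Fin m → Term m') {ρ : Fin m' → ℕ} {ρ' : Fin m → ℕ}
    → (∀ i → evalT ρ (σ i) ≡ ρ' i) → ∀ φ → eval D B (substF σ φ) ρ ≡ eval D B φ ρ'
  substF-eval {B = B} σ {ρ} σρ≗ρ' (rel i ts) = cong (λ t → memb t (B i))
    (trans (sym (Vec.map-∘ (evalT ρ) (substT σ) ts)) (Vec.map-cong (substT-eval σρ≗ρ') ts))
  substF-eval σ σρ≗ρ' (t ≐ u)  =
    cong₂ (λ a b → does (a ℕ.≟ b)) (substT-eval σρ≗ρ' t) (substT-eval σρ≗ρ' u)
  substF-eval σ σρ≗ρ' (¬ᶠ φ)   = cong not (substF-eval σ σρ≗ρ' φ)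
  substF-eval σ σρ≗ρ' (φ ∧ᶠ ψ) = cong₂ _∧_ (substF-eval σ σρ≗ρ' φ) (substF-eval σ σρ≗ρ' ψ)
  substF-eval σ σρ≗ρ' (φ ∨ᶠ ψ) = cong₂ _∨_ (substF-eval σ σρ≗ρ' φ) (substF-eval σ σρ≗ρ' ψ)
  substF-eval {D} σ σρ≗ρ' (∃ᶠ φ) =
    any-cong D λ {a} _ → substF-eval (liftTerm σ) (liftTerm-eval σ a σρ≗ρ') φ
  substF-eval {D} σ σρ≗ρ' (∀ᶠ φ) =
    all-cong D λ {a} _ → substF-eval (liftTerm σ) (liftTerm-eval σ a σρ≗ρ') φ

  constsT-substT : ∀ {m m'} (σ : Fin m → Term m') t → constsT t ⊆ constsT (substT σ t)
  constsT-substT σ (var i)   ()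
  constsT-substT σ (const a) = ⊆-refl

  consts-substF : ∀ {m m'} (σ : Fin m → Term m') φ → consts φ ⊆ consts (substF σ φ)
  consts-substF σ (rel i ts) = constsTs ts
    where
    constsTs : ∀ {k} (ts : Vec (Term _) k)
      → concatMap constsT (toList ts) ⊆ concatMap constsT (toList (Vec.map (substT σ) ts))
    constsTs []       = ⊆-refl
    constsTs (t ∷ ts) = ++⁺ (constsT-substT σ t) (constsTs ts)
  consts-substF σ (t ≐ u)  = ++⁺ (constsT-substT σ t) (constsT-substT σ u)
  consts-substF σ (¬ᶠ φ)   = consts-substF σ φ
  consts-substF σ (φ ∧ᶠ ψ) = ++⁺ (consts-substF σ φ) (consts-substF σ ψ)
  consts-substF σ (φ ∨ᶠ ψ) = ++⁺ (consts-substF σ φ) (consts-substF σ ψ)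
  consts-substF σ (∃ᶠ φ)   = consts-substF (liftTerm σ) φ
  consts-substF σ (∀ᶠ φ)   = consts-substF (liftTerm σ) φ

  extend-∈ : ∀ {m D a} {ρ : Fin m → ℕ} → a ∈ D → (∀ i → ρ i ∈ D) → ∀ i → extend a ρ i ∈ D
  extend-∈ a∈D ρ∈D zero    = a∈D
  extend-∈ a∈D ρ∈D (suc i) = ρ∈D i

  lookup-evalTs-∈ : ∀ {m k D} {ρ : Fin m → ℕ} (ss : Vec (Term m) k)
    → (∀ j → ρ j ∈ D) → concatMap constsT (toList ss) ⊆ D
    → ∀ i → lookup (Vec.map (evalT ρ) ss) i ∈ D
  lookup-evalTs-∈ (var j ∷ ss)   ρ∈D ss⊆D zero    = ρ∈D j
  lookup-evalTs-∈ (const a ∷ ss) ρ∈D ss⊆D zero    = ss⊆D (here refl)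
  lookup-evalTs-∈ (s ∷ ss)       ρ∈D ss⊆D (suc i) =
    lookup-evalTs-∈ ss ρ∈D (ss⊆D ∘ ∈-++⁺ʳ (constsT s)) i

  module _ (r : Fin n) (F : ∀ {m} → Vec (Term m) (ar r) → Formula m) where

    consts-replaceRel : (∀ {m} (ss : Vec (Term m) (ar r)) → consts (rel r ss) ⊆ consts (F ss))
      → ∀ {m} (c : Formula m) → consts c ⊆ consts (replaceRel r F c)
    consts-replaceRel F⊇ (rel i ts) with i ≟ r
    ... | yes refl = F⊇ ts
    ... | no _     = ⊆-refl
    consts-replaceRel F⊇ (t ≐ u)  = ⊆-refl
    consts-replaceRel F⊇ (¬ᶠ φ)   = consts-replaceRel F⊇ φ
    consts-replaceRel F⊇ (φ ∧ᶠ ψ) = ++⁺ (consts-replaceRel F⊇ φ) (consts-replaceRel F⊇ ψ)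
    consts-replaceRel F⊇ (φ ∨ᶠ ψ) = ++⁺ (consts-replaceRel F⊇ φ) (consts-replaceRel F⊇ ψ)
    consts-replaceRel F⊇ (∃ᶠ φ)   = consts-replaceRel F⊇ φ
    consts-replaceRel F⊇ (∀ᶠ φ)   = consts-replaceRel F⊇ φ

    module _ {D B X} {R : List (Vec ℕ (ar r))}
      (F-defines-R : ∀ {m} (ss : Vec (Term m) (ar r)) (ρ : Fin m → ℕ) → (∀ i → ρ i ∈ D)
        → consts (F ss) ⊆ X → eval D B (F ss) ρ ≡ memb (Vec.map (evalT ρ) ss) R) where

      eval-replaceRel : ∀ {m} (c : Formula m) (ρ : Fin m → ℕ) → (∀ i → ρ i ∈ D)
        → consts (replaceRel r F c) ⊆ X
        → eval D B (replaceRel r F c) ρ ≡ eval D (B [ r ≔ R ]) c ρ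
      eval-replaceRel (rel i ts) ρ ρ∈D c⊆X with i ≟ r
      ... | yes refl = F-defines-R ts ρ ρ∈D c⊆X
      ... | no _     = refl
      eval-replaceRel (t ≐ u)  ρ ρ∈D c⊆X = refl
      eval-replaceRel (¬ᶠ φ)   ρ ρ∈D c⊆X = cong not (eval-replaceRel φ ρ ρ∈D c⊆X)
      eval-replaceRel (φ ∧ᶠ ψ) ρ ρ∈D c⊆X = cong₂ _∧_
        (eval-replaceRel φ ρ ρ∈D (c⊆X ∘ xs⊆xs++ys _ _))
        (eval-replaceRel ψ ρ ρ∈D (c⊆X ∘ xs⊆ys++xs _ (consts (replaceRel r F φ))))
      eval-replaceRel (φ ∨ᶠ ψ) ρ ρ∈D c⊆X = cong₂ _∨_
        (eval-replaceRel φ ρ ρ∈D (c⊆X ∘ xs⊆xs++ys _ _))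
        (eval-replaceRel ψ ρ ρ∈D (c⊆X ∘ xs⊆ys++xs _ (consts (replaceRel r F φ))))
      eval-replaceRel (∃ᶠ φ)   ρ ρ∈D c⊆X =
        any-cong D λ a∈D → eval-replaceRel φ _ (extend-∈ a∈D ρ∈D) c⊆X
      eval-replaceRel (∀ᶠ φ)   ρ ρ∈D c⊆X =
        all-cong D λ a∈D → eval-replaceRel φ _ (extend-∈ a∈D ρ∈D) c⊆X

  evalAdom : DB → Sentence → (Fin 0 → ℕ) → Bool
  evalAdom B φ = eval (adom B ++ consts φ) B φ

  eval-domInd : ∀ (φ : Sentence) → DomInd φ → ∀ {B D} → adom B ++ consts φ ⊆ D
    → ∀ ρ → eval D B φ ρ ≡ evalAdom B φ ρ
  eval-domInd φ dφ {B} {D} φ⊆D ρ = ⇔→≡ (mk⇔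
    (λ e → proj₂ (Equivalence.to   (dφ B D _ φ⊆D ⊆-refl ρ) ((λ ()) , e)))
    (λ e → proj₂ (Equivalence.from (dφ B D _ φ⊆D ⊆-refl ρ) ((λ ()) , e))))

  domInd-sentence : ∀ (φ : Sentence) (value : DB → (Fin 0 → ℕ) → Bool)
    → (∀ {B D} → adom B ++ consts φ ⊆ D → ∀ ρ → eval D B φ ρ ≡ value B ρ) → DomInd φ
  domInd-sentence φ value eval≡ B D₁ D₂ φ⊆D₁ φ⊆D₂ ρ =
    mk⇔ (Product.map (λ _ ()) (trans (sym agree))) (Product.map (λ _ ()) (trans agree))
    where
    agree : eval D₁ B φ ρ ≡ eval D₂ B φ ρ
    agree = trans (eval≡ φ⊆D₁ ρ) (sym (eval≡ φ⊆D₂ ρ))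

  answerOver : ∀ {k} → List ℕ → DB → Formula k → List (Vec ℕ k)
  answerOver {k} Y B Φ = filterᵇ (λ t → eval Y B Φ (lookup t)) (tuples k Y)

  memb-answerOver : ∀ {k} (Φ : Formula k) → DomInd Φ → ∀ B {Y D} {t : Vec ℕ k}
    → adom B ++ consts Φ ⊆ Y → adom B ++ consts Φ ⊆ D → (∀ i → lookup t i ∈ D)
    → memb t (answerOver Y B Φ) ≡ eval D B Φ (lookup t)
  memb-answerOver {k} Φ dΦ B {Y} {D} {t} Φ⊆Y Φ⊆D t∈D =
    trans (memb-filterᵇ _ t (tuples k Y)) (⇔→≡ (mk⇔ to from))
    where
    Y⇔D = dΦ B Y D Φ⊆Y Φ⊆D (lookup t)
    to : memb t (tuples k Y) ∧ eval Y B Φ (lookup t) ≡ true → eval D B Φ (lookup t) ≡ true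
    to e = proj₂ (Equivalence.to Y⇔D
      (∈-tuples⁻ (memb-sound (∧-conicalˡ _ _ e)) , ∧-conicalʳ _ _ e))
    from : eval D B Φ (lookup t) ≡ true → memb t (tuples k Y) ∧ eval Y B Φ (lookup t) ≡ true
    from e with Equivalence.from Y⇔D (t∈D , e)
    ... | t∈Y , e′ = trans (cong (_∧ eval Y B Φ (lookup t)) (memb-complete (∈-tuples⁺ t∈Y))) e′

  entries-answerOver : ∀ {k} Y B (Φ : Formula k) → entries (answerOver Y B Φ) ⊆ Y
  entries-answerOver {k} Y B Φ a∈ with find (∈-concatMap⁻ toList {xs = answerOver Y B Φ} a∈)
  ... | t , t∈ , a∈t = toList-⊆ (∈-tuples⁻ (filter-⊆ _ (tuples k Y) t∈)) a∈t

  -- Insertion and deletion differ only in this operation.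
  record DefinableRelOp : Set where
    field
      _⊕_  : Bool → Bool → Bool
      _⊕ᶠ_ : ∀ {m} → Formula m → Formula m → Formula m
      _⊕ᴿ_ : ∀ {k} → List (Vec ℕ k) → List (Vec ℕ k) → List (Vec ℕ k)
      eval-⊕ᶠ    : ∀ D B {m} (φ ψ : Formula m) ρ
                   → eval D B (φ ⊕ᶠ ψ) ρ ≡ eval D B φ ρ ⊕ eval D B ψ ρ
      consts-⊕ᶠ  : ∀ {m} (φ ψ : Formula m) → consts (φ ⊕ᶠ ψ) ≡ consts φ ++ consts ψ
      memb-⊕ᴿ    : ∀ {k} (t : Vec ℕ k) R S → memb t (R ⊕ᴿ S) ≡ memb t R ⊕ memb t S
      entries-⊕ᴿ : ∀ {k} (R S : List (Vec ℕ k)) → entries (R ⊕ᴿ S) ⊆ entries R ++ entries S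

  union : DefinableRelOp
  union = record
    { _⊕_        = _∨_
    ; _⊕ᶠ_       = _∨ᶠ_
    ; _⊕ᴿ_       = _++_
    ; eval-⊕ᶠ    = λ _ _ _ _ _ → refl
    ; consts-⊕ᶠ  = λ _ _ → refl
    ; memb-⊕ᴿ    = memb-++
    ; entries-⊕ᴿ = λ R S → ⊆-reflexive (concatMap-++ toList R S)
    }

  difference : DefinableRelOp
  difference = record
    { _⊕_        = λ a b → a ∧ not b
    ; _⊕ᶠ_       = λ φ ψ → φ ∧ᶠ ¬ᶠ ψ
    ; _⊕ᴿ_       = λ R S → filterᵇ (λ t → not (memb t S)) R
    ; eval-⊕ᶠ    = λ _ _ _ _ _ → refl
    ; consts-⊕ᶠ  = λ _ _ → refl
    ; memb-⊕ᴿ    = λ t R S → memb-filterᵇ _ t R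
    ; entries-⊕ᴿ = λ R S → xs⊆xs++ys _ _ ∘ concatMap⁺ toList (filter-⊆ _ R)
    }

  record ExactPrecond (f : DB → DB) (c w : Sentence) : Set where
    constructor exactPrecond
    field satB-exact : ∀ B → satB B w ≡ satB (f B) c
  open ExactPrecond

  exactPrecond-∘ : ∀ {f g : DB → DB} {c w w′}
    → ExactPrecond f c w → ExactPrecond g w w′ → ExactPrecond (f ∘ g) c w′
  exactPrecond-∘ {g = g} (exactPrecond f≡) (exactPrecond g≡) =
    exactPrecond λ B → trans (g≡ B) (f≡ (g B))

  module Foreach (op : DefinableRelOp) (r : Fin n) (Φ : Formula (ar r)) (dΦ : DomInd Φ) where
    open DefinableRelOp op

    r⊕Φ : ∀ {m} → Vec (Term m) (ar r) → Formula m
    r⊕Φ ss = rel r ss ⊕ᶠ instantiate Φ ss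

    _[r↦r⊕Φ] : ∀ {m} → Formula m → Formula m
    c [r↦r⊕Φ] = replaceRel r r⊕Φ c

    update : List ℕ → DB → DB
    update Y B = B [ r ≔ B r ⊕ᴿ answerOver Y B Φ ]

    eval-r⊕Φ : ∀ {m B Y D} (ss : Vec (Term m) (ar r)) (ρ : Fin m → ℕ)
      → adom B ++ consts Φ ⊆ Y → adom B ++ consts Φ ⊆ D
      → (∀ i → ρ i ∈ D) → consts (rel r ss) ⊆ D
      → eval D B (r⊕Φ ss) ρ ≡ memb (Vec.map (evalT ρ) ss) (B r ⊕ᴿ answerOver Y B Φ)
    eval-r⊕Φ {B = B} {Y} {D} ss ρ Φ⊆Y Φ⊆D ρ∈D ss⊆D = begin
      eval D B (r⊕Φ ss) ρ                            ≡⟨ eval-⊕ᶠ D B _ _ ρ ⟩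
      memb t (B r) ⊕ eval D B (instantiate Φ ss) ρ   ≡⟨ cong (memb t (B r) ⊕_) Φ[ss]≡Φ[t] ⟩
      memb t (B r) ⊕ eval D B Φ (lookup t)           ≡⟨ cong (memb t (B r) ⊕_) t∈answer ⟨
      memb t (B r) ⊕ memb t (answerOver Y B Φ)       ≡⟨ memb-⊕ᴿ t (B r) _ ⟨
      memb t (B r ⊕ᴿ answerOver Y B Φ)               ∎
      where
      open ≡-Reasoning
      t = Vec.map (evalT ρ) ss
      Φ[ss]≡Φ[t] = substF-eval (lookup ss) (λ i → sym (lookup-map i (evalT ρ) ss)) Φ
      t∈answer = memb-answerOver Φ dΦ B Φ⊆Y Φ⊆D (lookup-evalTs-∈ ss ρ∈D ss⊆D)

    consts-r⊕Φ : ∀ {m} (ss : Vec (Term m) (ar r))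
      → consts (rel r ss) ++ consts Φ ⊆ consts (r⊕Φ ss)
    consts-r⊕Φ ss = ⊆-trans (++⁺ʳ (consts (rel r ss)) (consts-substF (lookup ss) Φ))
                            (⊆-reflexive (sym (consts-⊕ᶠ (rel r ss) (instantiate Φ ss))))

    adom-update-⊆ : ∀ Y B → adom (update Y B) ⊆ adom B ++ Y
    adom-update-⊆ Y B = ⊆-trans (adom-[≔]-⊆ B r _)
      (++-⊆ (xs⊆xs++ys _ _) (⊆-trans (entries-⊕ᴿ _ _)
        (++-⊆ (xs⊆xs++ys _ _ ∘ entries-⊆-adom B r) (xs⊆ys++xs _ _ ∘ entries-answerOver Y B Φ))))

    -- If r does not occur in c, consts Φ need not lie in X; but then no answer to Φ is consulted.
    eval-[r↦r⊕Φ] : ∀ (c : Sentence) {B Y D} → let X = adom B ++ consts (c [r↦r⊕Φ]) in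
      X ⊆ D → (consts Φ ⊆ X → adom B ++ consts Φ ⊆ Y)
      → ∀ ρ → eval D B (c [r↦r⊕Φ]) ρ ≡ eval D (update Y B) c ρ
    eval-[r↦r⊕Φ] c {B} {Y} {D} X⊆D Φ⊆Y ρ =
      eval-replaceRel r r⊕Φ r⊕Φ-defines c ρ (λ ()) (xs⊆ys++xs _ (adom B))
      where
      r⊕Φ-defines : ∀ {m} (ss : Vec (Term m) (ar r)) (ρ : Fin m → ℕ) → (∀ i → ρ i ∈ D)
        → consts (r⊕Φ ss) ⊆ adom B ++ consts (c [r↦r⊕Φ])
        → eval D B (r⊕Φ ss) ρ ≡ memb (Vec.map (evalT ρ) ss) (B r ⊕ᴿ answerOver Y B Φ)
      r⊕Φ-defines ss ρ ρ∈D r⊕Φ⊆X = eval-r⊕Φ ss ρ (Φ⊆Y Φ⊆X)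
        (++-⊆ (X⊆D ∘ xs⊆xs++ys _ _) (X⊆D ∘ Φ⊆X)) ρ∈D
        (X⊆D ∘ r⊕Φ⊆X ∘ consts-r⊕Φ ss ∘ xs⊆xs++ys _ _)
        where
        Φ⊆X : consts Φ ⊆ adom B ++ consts (c [r↦r⊕Φ])
        Φ⊆X = r⊕Φ⊆X ∘ consts-r⊕Φ ss ∘ xs⊆ys++xs _ _

    domInd-[r↦r⊕Φ] : ∀ (c : Sentence) → DomInd c → DomInd (c [r↦r⊕Φ])
    domInd-[r↦r⊕Φ] c dc =
      domInd-sentence (c [r↦r⊕Φ]) (λ B → evalAdom (update (X B) B) c) λ {B} X⊆D ρ →
        trans (eval-[r↦r⊕Φ] c X⊆D (++-⊆ (xs⊆xs++ys (adom B) _)) ρ)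
              (eval-domInd c dc (updated⊆D X⊆D) ρ)
      where
      X : DB → List ℕ
      X B = adom B ++ consts (c [r↦r⊕Φ])
      rel⊆r⊕Φ : ∀ {m} (ss : Vec (Term m) (ar r)) → consts (rel r ss) ⊆ consts (r⊕Φ ss)
      rel⊆r⊕Φ ss = consts-r⊕Φ ss ∘ xs⊆xs++ys _ _
      updated⊆D : ∀ {B D} → X B ⊆ D → adom (update (X B) B) ++ consts c ⊆ D
      updated⊆D {B} X⊆D = ++-⊆
        (X⊆D ∘ ++-⊆ (xs⊆xs++ys (adom B) _) ⊆-refl ∘ adom-update-⊆ (X B) B)
        (X⊆D ∘ xs⊆ys++xs _ (adom B) ∘ consts-replaceRel r r⊕Φ rel⊆r⊕Φ c)

    satB-[r↦r⊕Φ] : ∀ (c : Sentence) → DomInd c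
      → ∀ B → satB B (c [r↦r⊕Φ]) ≡ satB (update (adom B ++ consts Φ) B) c
    satB-[r↦r⊕Φ] c dc B = begin
      satB B (c [r↦r⊕Φ])     ≡⟨ eval-domInd (c [r↦r⊕Φ]) (domInd-[r↦r⊕Φ] c dc) (xs⊆xs++ys X _) _ ⟨
      eval D B (c [r↦r⊕Φ]) _ ≡⟨ eval-[r↦r⊕Φ] c (xs⊆xs++ys X _) (λ _ → ⊆-refl) _ ⟩
      eval D B′ c _          ≡⟨ eval-domInd c dc (xs⊆ys++xs _ X) _ ⟩
      satB B′ c              ∎
      where
      open ≡-Reasoning
      X  = adom B ++ consts (c [r↦r⊕Φ])
      B′ = update (adom B ++ consts Φ) B
      D  = X ++ (adom B′ ++ consts c)

    exactPrecond-[r↦r⊕Φ] : ∀ (c : Sentence) → DomInd c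
      → ExactPrecond (λ B → update (adom B ++ consts Φ) B) c (c [r↦r⊕Φ])
    exactPrecond-[r↦r⊕Φ] c dc = exactPrecond (satB-[r↦r⊕Φ] c dc)

  ifᶠ_then_else_ : Sentence → Sentence → Sentence → Sentence
  ifᶠ cond then w₁ else w₂ = (cond ∧ᶠ w₁) ∨ᶠ (¬ᶠ cond ∧ᶠ w₂)

  module _ (cond w₁ w₂ : Sentence) (dcond : DomInd cond) (dw₁ : DomInd w₁) (dw₂ : DomInd w₂) where

    eval-ifᶠ : ∀ {B D} → adom B ++ consts (ifᶠ cond then w₁ else w₂) ⊆ D → ∀ ρ
      → eval D B (ifᶠ cond then w₁ else w₂) ρ
        ≡ (if evalAdom B cond ρ then evalAdom B w₁ ρ else evalAdom B w₂ ρ)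
    eval-ifᶠ {B} {D} ite⊆D ρ = trans
      (cong₂ _∨_ (cong₂ _∧_ (at cond dcond cond⊆) (at w₁ dw₁ w₁⊆))
                 (cong₂ _∧_ (cong not (at cond dcond cond⊆)) (at w₂ dw₂ w₂⊆)))
      (∧-∨-not≡if (evalAdom B cond ρ) (evalAdom B w₁ ρ) (evalAdom B w₂ ρ))
      where
      at : ∀ φ → DomInd φ → consts φ ⊆ consts (ifᶠ cond then w₁ else w₂)
        → eval D B φ ρ ≡ evalAdom B φ ρ
      at φ dφ φ⊆ite = eval-domInd φ dφ (ite⊆D ∘ ++⁺ʳ (adom B) φ⊆ite) ρ
      cond⊆ : consts cond ⊆ consts (ifᶠ cond then w₁ else w₂)
      cond⊆ = xs⊆xs++ys _ _ ∘ xs⊆xs++ys _ _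
      w₁⊆ : consts w₁ ⊆ consts (ifᶠ cond then w₁ else w₂)
      w₁⊆ = xs⊆xs++ys _ _ ∘ xs⊆ys++xs _ (consts cond)
      w₂⊆ : consts w₂ ⊆ consts (ifᶠ cond then w₁ else w₂)
      w₂⊆ = xs⊆ys++xs _ (consts cond ++ consts w₁) ∘ xs⊆ys++xs _ (consts cond)

    domInd-ifᶠ : DomInd (ifᶠ cond then w₁ else w₂)
    domInd-ifᶠ = domInd-sentence (ifᶠ cond then w₁ else w₂)
      (λ B ρ → if evalAdom B cond ρ then evalAdom B w₁ ρ else evalAdom B w₂ ρ) eval-ifᶠ

    exactPrecond-ifᶠ : ∀ {c} {f₁ f₂ : DB → DB} → ExactPrecond f₁ c w₁ → ExactPrecond f₂ c w₂
      → ExactPrecond (λ B → if satB B cond then f₁ B else f₂ B) c (ifᶠ cond then w₁ else w₂)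
    exactPrecond-ifᶠ {c} {f₁} {f₂} (exactPrecond w₁≡) (exactPrecond w₂≡) = exactPrecond λ B → begin
      satB B (ifᶠ cond then w₁ else w₂)                      ≡⟨ eval-ifᶠ ⊆-refl _ ⟩
      (if satB B cond then satB B w₁ else satB B w₂)         ≡⟨ if-cong₂ (satB B cond) (w₁≡ B) (w₂≡ B) ⟩
      (if satB B cond then satB (f₁ B) c else satB (f₂ B) c) ≡⟨ if-float (λ B′ → satB B′ c) (satB B cond) ⟨
      satB (if satB B cond then f₁ B else f₂ B) c            ∎
      where open ≡-Reasoning

  exactPrecond-exists : ∀ {c} → DomInd c → ∀ i → ∃[ w ] DomInd w × ExactPrecond (run i) c w
  exactPrecond-exists {c} dc (foreachInsert r Φ dΦ) = c [ r ↦r∪ Φ ] ,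
    Foreach.domInd-[r↦r⊕Φ] union r Φ dΦ c dc , Foreach.exactPrecond-[r↦r⊕Φ] union r Φ dΦ c dc
  exactPrecond-exists {c} dc (foreachDelete r Φ dΦ) = c [ r ↦r- Φ ] ,
    Foreach.domInd-[r↦r⊕Φ] difference r Φ dΦ c dc ,
    Foreach.exactPrecond-[r↦r⊕Φ] difference r Φ dΦ c dc
  exactPrecond-exists dc (i₁ ⨾ i₂) with exactPrecond-exists dc i₂
  ... | w₂ , dw₂ , w₂≡ with exactPrecond-exists dw₂ i₁
  ... | w₁ , dw₁ , w₁≡ = w₁ , dw₁ , exactPrecond-∘ w₂≡ w₁≡
  exactPrecond-exists dc (ifThenElse cond dcond i₁ i₂)
    with exactPrecond-exists dc i₁ | exactPrecond-exists dc i₂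
  ... | w₁ , dw₁ , w₁≡ | w₂ , dw₂ , w₂≡ = ifᶠ cond then w₁ else w₂ ,
    domInd-ifᶠ cond w₁ w₂ dcond dw₁ dw₂ , exactPrecond-ifᶠ cond w₁ w₂ dcond dw₁ dw₂ w₁≡ w₂≡
  exactPrecond-exists {c} dc (ifThen cond dcond i) with exactPrecond-exists dc i
  ... | w , dw , w≡ = ifᶠ cond then w else c ,
    domInd-ifᶠ cond w c dcond dw dc ,
    exactPrecond-ifᶠ cond w c dcond dw dc w≡ (exactPrecond λ _ → refl)

  exactPrecond⇒IsWP : ∀ i c w → DomInd w → ExactPrecond (run i) c w → IsWP i c w
  exactPrecond⇒IsWP i c w dw (exactPrecond w≡) =
    dw , (λ B ⊨w → trans (sym (w≡ B)) ⊨w) , λ g dg g-pre B ⊨g → trans (w≡ B) (g-pre B ⊨g)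

  IsWP⇒exactPrecond : ∀ i c w → DomInd c → IsWP i c w → ExactPrecond (run i) c w
  IsWP⇒exactPrecond i c w dc (_ , w-pre , w-weakest) with exactPrecond-exists dc i
  ... | v , dv , v≡ = exactPrecond λ B →
    ⇔→≡ (mk⇔ (w-pre B) λ ⊨c → w-weakest v dv v-pre B (trans (satB-exact v≡ B) ⊨c))
    where v-pre = proj₁ (proj₂ (exactPrecond⇒IsWP i c v dv v≡))

  wp-foreachInsert : ∀ c → DomInd c → ∀ r Φ dΦ → IsWP (foreachInsert r Φ dΦ) c (c [ r ↦r∪ Φ ])
  wp-foreachInsert c dc r Φ dΦ = exactPrecond⇒IsWP (foreachInsert r Φ dΦ) c (c [ r ↦r∪ Φ ])
    (Foreach.domInd-[r↦r⊕Φ] union r Φ dΦ c dc) (Foreach.exactPrecond-[r↦r⊕Φ] union r Φ dΦ c dc)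

  wp-foreachDelete : ∀ c → DomInd c → ∀ r Φ dΦ → IsWP (foreachDelete r Φ dΦ) c (c [ r ↦r- Φ ])
  wp-foreachDelete c dc r Φ dΦ = exactPrecond⇒IsWP (foreachDelete r Φ dΦ) c (c [ r ↦r- Φ ])
    (Foreach.domInd-[r↦r⊕Φ] difference r Φ dΦ c dc)
    (Foreach.exactPrecond-[r↦r⊕Φ] difference r Φ dΦ c dc)

  wp-⨾ : ∀ c → DomInd c → ∀ i₁ i₂ w₂ w₁ → IsWP i₂ c w₂ → IsWP i₁ w₂ w₁ → IsWP (i₁ ⨾ i₂) c w₁
  wp-⨾ c dc i₁ i₂ w₂ w₁ wp₂@(dw₂ , _) wp₁@(dw₁ , _) = exactPrecond⇒IsWP (i₁ ⨾ i₂) c w₁ dw₁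
    (exactPrecond-∘ (IsWP⇒exactPrecond i₂ c w₂ dc wp₂) (IsWP⇒exactPrecond i₁ w₂ w₁ dw₂ wp₁))

  wp-ifThenElse : ∀ c → DomInd c → ∀ cond dcond i₁ i₂ w₁ w₂ → IsWP i₁ c w₁ → IsWP i₂ c w₂
    → IsWP (ifThenElse cond dcond i₁ i₂) c (ifᶠ cond then w₁ else w₂)
  wp-ifThenElse c dc cond dcond i₁ i₂ w₁ w₂ wp₁@(dw₁ , _) wp₂@(dw₂ , _) =
    exactPrecond⇒IsWP (ifThenElse cond dcond i₁ i₂) c (ifᶠ cond then w₁ else w₂)
      (domInd-ifᶠ cond w₁ w₂ dcond dw₁ dw₂)
      (exactPrecond-ifᶠ cond w₁ w₂ dcond dw₁ dw₂
        (IsWP⇒exactPrecond i₁ c w₁ dc wp₁) (IsWP⇒exactPrecond i₂ c w₂ dc wp₂))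

theorem1 : (n : ℕ) (ar : Fin n → ℕ) → let open WithSchema n ar in
  (c : Sentence) → DomInd c →
    ((r : Fin n) (Φ : Formula (ar r)) (dΦ : DomInd Φ) →
       IsWP (foreachInsert r Φ dΦ) c (c [ r ↦r∪ Φ ]))
  × ((r : Fin n) (Φ : Formula (ar r)) (dΦ : DomInd Φ) →
       IsWP (foreachDelete r Φ dΦ) c (c [ r ↦r- Φ ]))
  × ((i₁ i₂ : Instr) (w₂ w₁ : Sentence) →
       IsWP i₂ c w₂ → IsWP i₁ w₂ w₁ → IsWP (i₁ ⨾ i₂) c w₁)
  × ((cond : Sentence) (dcond : DomInd cond) (inst1 inst2 : Instr) (w₁ w₂ : Sentence) →
       IsWP inst1 c w₁ → IsWP inst2 c w₂ →
       IsWP (ifThenElse cond dcond inst1 inst2) c ((cond ∧ᶠ w₁) ∨ᶠ (¬ᶠ cond ∧ᶠ w₂)))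
theorem1 n ar c dc =
  wp-foreachInsert n ar c dc , wp-foreachDelete n ar c dc , wp-⨾ n ar c dc , wp-ifThenElse n ar c dc
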